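{- Let $P$ and $Q$ be well-founded posets and let $(\mathcal{I},\mathcal{F})$ be a cut for $\mathrm{Pro}(P,Q)$. Then $(D(\mathcal{F}),D(\mathcal{I}))$ is a cut for $\mathrm{Pro}(Q,P)$, where $D(\mathcal{X})=\{Df: f\in\mathcal{X}\}$. Let $\mathcal{A}=\{S\subseteq Q\times P: S\supseteq\Lambda f\text{ for some } f\in\mathcal{F}\}$ and $\mathcal{A}'=\{T\subseteq P\times Q: T\supseteq \Lambda g \text{ for some } g\in D(\mathcal{I})\}$. Then $\mathcal{A}'$ is the Alexander dual of $\mathcal{A}$: $$\mathcal{A}'=\{\,((Q\times P)\setminus S)^{op} \;:\; S\subseteq Q\times P,\ S\notin\mathcal{A}\,\}.$$ In other words, the map sending a cut $(\mathcal{I},\mathcal{F})$ of $\mathrm{Pro}(P,Q)$ to the up-set generated by the ascents of elements of $\mathcal{F}$ commutes with the dualities on both sides.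
   Context: A poset is well-founded if every nonempty subset has a minimal element. $\widehat{Q}$ is the set of down-sets of $Q$ ordered by inclusion. A profunctor $f:P\to Q$ is an order-preserving map $f:P\to\widehat{Q}$; $\mathrm{Pro}(P,Q)$ is ordered pointwise by inclusion. The dual of $f\in\mathrm{Pro}(P,Q)$ is $Df\in\mathrm{Pro}(Q,P)$, $Df(q)=\{p\in P: q\notin f(p)\}$; $D$ is an order-reversing bijection $\mathrm{Pro}(P,Q)\to\mathrm{Pro}(Q,P)$. A cut for a poset $X$ is a pair $(I,F)$ with $I$ a down-set and $F=X\setminus I$. For $f\in\mathrm{Pro}(P,Q)$, the ascent is $\Lambda f=\{(q,p)\in Q\times P : q\in f(p),\ q\notin f(p')\ \forall p'<p\}$ (similarly for profunctors $Q\to P$, giving subsets of $P\times Q$). For $X\subseteq Q\times P$, $X^{op}=\{(p,q):(q,p)\in X\}$. -}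

module Defs where

open import Level using (Level; 0ℓ) renaming (suc to lsuc)
open import Data.Product using (Σ; ∃; _×_; _,_)
open import Relation.Nullary using (¬_)
open import Relation.Binary using (Rel; IsPartialOrder)
open import Relation.Binary.PropositionalEquality using (_≡_; _≢_)
open import Function.Bundles using (_⇔_)

record Pos : Set₁ where
  field
    Carrier        : Set
    _≤_            : Rel Carrier 0ℓ
    isPartialOrder : IsPartialOrder _≡_ _≤_

  _<_ : Rel Carrier 0ℓ
  x < y = (x ≤ y) × (x ≢ y)

open Pos public using (Carrier)

Subset : Set → Set₁
Subset X = X → Set

WellFounded : Pos → Set₁
WellFounded P = (S : Subset (Carrier P)) → (∃ λ x → S x) →
  ∃ λ m → S m × ((y : Carrier P) → S y → ¬ (Pos._<_ P y m))

record DownSet (Q : Pos) : Set₁ where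
  field
    mem    : Carrier Q → Set
    closed : ∀ {x y} → Pos._≤_ Q x y → mem y → mem x
open DownSet public

-- Profunctors P → Q: order-preserving maps P → \hat{Q} (inclusion order).
record Pro (P Q : Pos) : Set₁ where
  field
    app  : Carrier P → DownSet Q
    mono : ∀ {p p'} → Pos._≤_ P p p' → ∀ q → mem (app p) q → mem (app p') q
open Pro public

_∋_at_ : ∀ {P Q} → Pro P Q → Carrier Q → Carrier P → Set
f ∋ q at p = mem (app f p) q

_⊑_ : ∀ {P Q} → Pro P Q → Pro P Q → Set
_⊑_ {P} {Q} f g = ∀ (p : Carrier P) (q : Carrier Q) → f ∋ q at p → g ∋ q at p

_≋_ : ∀ {P Q} → Pro P Q → Pro P Q → Set
f ≋ g = (f ⊑ g) × (g ⊑ f)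

D : ∀ {P Q} → Pro P Q → Pro Q P
D {P} {Q} f = record
  { app  = λ q → record
      { mem    = λ p → ¬ (f ∋ q at p)
      ; closed = λ {p'} {p} p'≤p q∉fp q∈fp' → q∉fp (mono f p'≤p q q∈fp') }
  ; mono = λ {q} {q'} q≤q' p q∉fp q'∈fp → q∉fp (closed (app f p) q≤q' q'∈fp) }

DImg : ∀ {ℓ} {P Q} → (Pro P Q → Set ℓ) → Pro Q P → Set (ℓ Level.⊔ lsuc 0ℓ)
DImg X g = ∃ λ f → X f × (D f ≋ g)

IsCut : ∀ {ℓ} (P Q : Pos) → (Pro P Q → Set ℓ) → (Pro P Q → Set ℓ) → Set (ℓ Level.⊔ lsuc 0ℓ)
IsCut P Q I F =
  (∀ (f g : Pro P Q) → f ⊑ g → I g → I f) ×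
  (∀ (f : Pro P Q) → F f ⇔ (¬ I f))

Λ : ∀ {P Q} → Pro P Q → Subset (Carrier Q × Carrier P)
Λ {P} f (q , p) = (f ∋ q at p) × (∀ (p' : Carrier P) → Pos._<_ P p' p → ¬ (f ∋ q at p'))

_⊆_ : ∀ {X : Set} → Subset X → Subset X → Set
S ⊆ T = ∀ x → S x → T x

UpAsc : ∀ {ℓ} {P Q} → (Pro P Q → Set ℓ) → Subset (Carrier Q × Carrier P) → Set (ℓ Level.⊔ lsuc 0ℓ)
UpAsc X S = ∃ λ f → X f × (Λ f ⊆ S)

AlexDual : ∀ {ℓ} {X Y : Set} → (Subset (X × Y) → Set ℓ) → Subset (Y × X) → Set (ℓ Level.⊔ lsuc 0ℓ)
AlexDual {X = X} {Y} 𝒜 T = ∃ λ (S : Subset (X × Y)) →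
  (¬ 𝒜 S) × (∀ (y : Y) (x : X) → T (y , x) ⇔ (¬ S (x , y)))

{-# OPTIONS --safe #-}
module Submission where

-- The cut part holds because D is an order-reversing involution (classically). For the
-- Alexander duality, one inclusion comes from the fact that f ⋢ f' forces an ascent (q , p)
-- of f whose transpose is an ascent of D f': take p minimal among the points where f
-- exceeds f', then q minimal in f(p) ∖ f'(p). For the other, given T, the union of all
-- profunctors whose ascents avoid the transpose of T still has that property, and every
-- ascent of its dual lies in T; whichever side of the cut it falls on yields the claim.

open import Defs
open import Level using (0ℓ; lift; lower) renaming (suc to lsuc)
open import Data.Product using (_×_; _,_; proj₁; proj₂; ∃; ∃₂)
open import Data.Sum using (_⊎_; inj₁; inj₂)
open import Data.Empty using (⊥-elim)
open import Relation.Nullary using (¬_; Dec; yes; no)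
open import Relation.Nullary.Decidable using (map′; decidable-stable; True; toWitness; fromWitness)
open import Relation.Binary using (IsPartialOrder)
open import Relation.Binary.PropositionalEquality using (_≡_; refl)
open import Axiom.ExcludedMiddle using (ExcludedMiddle)
open import Function.Bundles using (_⇔_; mk⇔; Equivalence)

⊑-refl : ∀ {P Q} (f : Pro P Q) → f ⊑ f
⊑-refl f p q fq = fq

⊑-trans : ∀ {P Q} {f g h : Pro P Q} → f ⊑ g → g ⊑ h → f ⊑ h
⊑-trans f⊑g g⊑h p q fq = g⊑h p q (f⊑g p q fq)

⊑-D-swap : ∀ {P Q} {f : Pro P Q} {g : Pro Q P} → g ⊑ D f → f ⊑ D g
⊑-D-swap g⊑Df p q q∈fp p∈gq = g⊑Df q p p∈gq q∈fp

Λ-resp-≋ : ∀ {P Q} {f g : Pro P Q} → f ≋ g → Λ f ⊆ Λ g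
Λ-resp-≋ (f⊑g , g⊑f) (q , p) (q∈fp , minimal) =
  f⊑g p q q∈fp , λ p' p'<p q∈gp' → minimal p' p'<p (g⊑f p' q q∈gp')

≋-refl : ∀ {P Q} (f : Pro P Q) → f ≋ f
≋-refl f = ⊑-refl f , ⊑-refl f

_∪_ : ∀ {P Q} → Pro P Q → Pro P Q → Pro P Q
f ∪ g = record
  { app  = λ p → record
      { mem    = λ q → f ∋ q at p ⊎ g ∋ q at p
      ; closed = λ { q'≤q (inj₁ q∈fp) → inj₁ (closed (app f _) q'≤q q∈fp)
                   ; q'≤q (inj₂ q∈gp) → inj₂ (closed (app g _) q'≤q q∈gp) } }
  ; mono = λ { p≤p' q (inj₁ q∈fp) → inj₁ (mono f p≤p' q q∈fp)
             ; p≤p' q (inj₂ q∈gp) → inj₂ (mono g p≤p' q q∈gp) } }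

principal : ∀ {P Q} → Carrier Q → Carrier P → Pro P Q
principal {P} {Q} q p = record
  { app  = λ p' → record
      { mem    = λ q' → Pos._≤_ Q q' q × Pos._≤_ P p p'
      ; closed = λ { q''≤q' (q'≤q , p≤p') → Q.trans q''≤q' q'≤q , p≤p' } }
  ; mono = λ { p'≤p'' q' (q'≤q , p≤p') → q'≤q , P.trans p≤p' p'≤p'' } }
  where
  module P = IsPartialOrder (Pos.isPartialOrder P)
  module Q = IsPartialOrder (Pos.isPartialOrder Q)

principal-∋-generator : ∀ {P Q} (q : Carrier Q) (p : Carrier P) → principal {P} {Q} q p ∋ q at p
principal-∋-generator {P} {Q} q p =
  IsPartialOrder.refl (Pos.isPartialOrder Q) , IsPartialOrder.refl (Pos.isPartialOrder P)

Λ-∪ˡ : ∀ {P Q} {f g : Pro P Q} {q p} → f ∋ q at p → Λ (f ∪ g) (q , p) → Λ f (q , p)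
Λ-∪ˡ q∈fp (_ , minimal) = q∈fp , λ p' p'<p q∈fp' → minimal p' p'<p (inj₁ q∈fp')

DImg-of-D : ∀ {P Q} (X : Pro P Q → Set) (g : Pro Q P) → X (D g) → D (D g) ≋ g → DImg X g
DImg-of-D X g x DDg≋g = D g , x , DDg≋g

module Classical (em : ExcludedMiddle (lsuc 0ℓ)) where

  dec : (A : Set) → Dec A
  dec A = map′ lower lift em

  dne : {A : Set} → ¬ ¬ A → A
  dne {A} = decidable-stable (dec A)

  D-involutive : ∀ {P Q} (g : Pro Q P) → D (D g) ≋ g
  D-involutive g = (λ q p → dne) , (λ q p p∈gq p∉gq → p∉gq p∈gq)

  D-reflects-⊑ : ∀ {P Q} {f g : Pro P Q} → D f ⊑ D g → g ⊑ f
  D-reflects-⊑ Df⊑Dg p q q∈gp = dne λ q∉fp → Df⊑Dg q p q∉fp q∈gp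

  module _ {P Q : Pos} {I F : Pro P Q → Set} (cut : IsCut P Q I F) where

    ¬I⇒F : ∀ f → ¬ I f → F f
    ¬I⇒F f = Equivalence.from (proj₂ cut f)

    F⇒⋢I : ∀ {f f'} → F f → I f' → ¬ (f ⊑ f')
    F⇒⋢I {f} {f'} Ff If' f⊑f' = Equivalence.to (proj₂ cut f) Ff (proj₁ cut f f' f⊑f' If')

    DImg-F-down : ∀ (g g' : Pro Q P) → g ⊑ g' → DImg F g' → DImg F g
    DImg-F-down g g' g⊑g' (f , Ff , (_ , Df⊒g')) =
      DImg-of-D F g (¬I⇒F (D g) λ IDg → F⇒⋢I Ff IDg f⊑Dg) (D-involutive g)
      where
      f⊑Dg : f ⊑ D g
      f⊑Dg = ⊑-D-swap {f = f} {g = g} (⊑-trans {f = g} {g'} {D f} g⊑g' Df⊒g')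

    DImg-I⇔¬DImg-F : ∀ (g : Pro Q P) → DImg I g ⇔ (¬ DImg F g)
    DImg-I⇔¬DImg-F g = mk⇔ to from
      where
      to : DImg I g → ¬ DImg F g
      to (f , If , (Df⊑g , _)) (f' , Ff' , (_ , g⊑Df')) =
        F⇒⋢I Ff' If (D-reflects-⊑ {f = f} {f'} (⊑-trans {f = D f} {g} {D f'} Df⊑g g⊑Df'))
      from : ¬ DImg F g → DImg I g
      from ¬DFg with dec (I (D g))
      ... | yes IDg = DImg-of-D I g IDg (D-involutive g)
      ... | no ¬IDg = ⊥-elim (¬DFg (DImg-of-D F g (¬I⇒F (D g) ¬IDg) (D-involutive g)))

    cut-dual : IsCut Q P (DImg F) (DImg I)
    cut-dual = DImg-F-down , DImg-I⇔¬DImg-F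

  module _ {P Q : Pos} where

    Excess : Pro P Q → Pro P Q → Carrier P → Carrier Q → Set
    Excess f f' p q = (f ∋ q at p) × ¬ (f' ∋ q at p)

    ⋢⇒excess : ∀ {f f'} → ¬ (f ⊑ f') → ∃ λ p → ∃ (Excess f f' p)
    ⋢⇒excess f⋢f' = dne λ none → f⋢f' λ p q q∈fp → dne λ q∉f'p → none (p , q , q∈fp , q∉f'p)

    ⋢⇒shared-ascent : WellFounded P → WellFounded Q → (f f' : Pro P Q) → ¬ (f ⊑ f') →
      ∃₂ λ q p → Λ f (q , p) × Λ (D f') (p , q)
    ⋢⇒shared-ascent wfP wfQ f f' f⋢f'
      with wfP (λ p → ∃ (Excess f f' p)) (⋢⇒excess {f} {f'} f⋢f')
    ... | p₀ , excess-at-p₀ , p₀-minimal with wfQ (Excess f f' p₀) excess-at-p₀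
    ... | q₀ , (q₀∈fp₀ , q₀∉f'p₀) , q₀-minimal =
      q₀ , p₀ , (q₀∈fp₀ , q₀∉f-below-p₀) , (q₀∉f'p₀ , D-f'-misses-below-q₀)
      where
      q₀∉f-below-p₀ : ∀ p → Pos._<_ P p p₀ → ¬ (f ∋ q₀ at p)
      q₀∉f-below-p₀ p p<p₀ q₀∈fp with dec (f' ∋ q₀ at p)
      ... | yes q₀∈f'p = q₀∉f'p₀ (mono f' (proj₁ p<p₀) q₀ q₀∈f'p)
      ... | no q₀∉f'p = p₀-minimal p (q₀ , q₀∈fp , q₀∉f'p) p<p₀

      D-f'-misses-below-q₀ : ∀ q → Pos._<_ Q q q₀ → ¬ (D f' ∋ p₀ at q)
      D-f'-misses-below-q₀ q q<q₀ q∉f'p₀ =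
        q₀-minimal q (closed (app f p₀) (proj₁ q<q₀) q₀∈fp₀ , q∉f'p₀) q<q₀

    Λ-∪-principal : ∀ {f : Pro P Q} {q p q' p'} → Λ (D f) (p , q) →
      Λ (f ∪ principal q p) (q' , p') → ¬ (f ∋ q' at p') → q' ≡ q × p' ≡ p
    Λ-∪-principal {f} {q} {p} {q'} {p'} (_ , q-minimal) (q'∈hp' , p'-minimal) q'∉fp'
      with q'∈hp'
    ... | inj₁ q'∈fp' = ⊥-elim (q'∉fp' q'∈fp')
    ... | inj₂ (q'≤q , p≤p') with dec (q' ≡ q) | dec (p ≡ p')
    ...   | no q'≢q | _ =
      ⊥-elim (q-minimal q' (q'≤q , q'≢q) λ q'∈fp → q'∉fp' (mono f p≤p' q' q'∈fp))
    ...   | yes _ | no p≢p' =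
      ⊥-elim (p'-minimal p (p≤p' , p≢p') (inj₂ (q'≤q , proj₂ (principal-∋-generator {P} {Q} q p))))
    ...   | yes refl | yes refl = refl , refl

    AvoidsTranspose : Subset (Carrier P × Carrier Q) → Pro P Q → Set
    AvoidsTranspose T h = ∀ q p → Λ h (q , p) → ¬ T (p , q)

    module MaxAvoiding (T : Subset (Carrier P × Carrier Q)) where

      Covered : Carrier P → Carrier Q → Set₁
      Covered p q = ∃ λ h → AvoidsTranspose T h × (h ∋ q at p)

      -- Excluded middle at level 1 is what lets this Set₁-sized union be a Set-valued profunctor.
      maxAvoiding : Pro P Q
      maxAvoiding = record
        { app  = λ p → record
            { mem    = λ q → True (em {Covered p q})
            ; closed = λ q'≤q q∈Mp → let (h , h-avoids , q∈hp) = toWitness q∈Mp in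
                fromWitness (h , h-avoids , closed (app h p) q'≤q q∈hp) }
        ; mono = λ p≤p' q q∈Mp → let (h , h-avoids , q∈hp) = toWitness q∈Mp in
            fromWitness (h , h-avoids , mono h p≤p' q q∈hp) }

      ⊑maxAvoiding : ∀ {h} → AvoidsTranspose T h → h ⊑ maxAvoiding
      ⊑maxAvoiding {h} h-avoids p q q∈hp = fromWitness (h , h-avoids , q∈hp)

      maxAvoiding-avoids : AvoidsTranspose T maxAvoiding
      maxAvoiding-avoids q p (q∈Mp , minimal) =
        let (h , h-avoids , q∈hp) = toWitness q∈Mp in
        h-avoids q p (q∈hp , λ p' p'<p q∈hp' → minimal p' p'<p (⊑maxAvoiding {h} h-avoids p' q q∈hp'))

      Λ-D-maxAvoiding⊆ : Λ (D maxAvoiding) ⊆ T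
      Λ-D-maxAvoiding⊆ (p , q) ascent@(q∉Mp , _) =
        dne λ ¬Tpq → q∉Mp (⊑maxAvoiding {maxAvoiding ∪ principal q p} (extension-avoids ¬Tpq)
                                         p q (inj₂ (principal-∋-generator {P} {Q} q p)))
        where
        extension-avoids : ¬ T (p , q) → AvoidsTranspose T (maxAvoiding ∪ principal q p)
        extension-avoids ¬Tpq q' p' ascent' with dec (maxAvoiding ∋ q' at p')
        ... | yes q'∈Mp' = maxAvoiding-avoids q' p' (Λ-∪ˡ {f = maxAvoiding} {principal q p} q'∈Mp' ascent')
        ... | no q'∉Mp' with Λ-∪-principal {f = maxAvoiding} ascent ascent' q'∉Mp'
        ...   | refl , refl = ¬Tpq

    module _ {I F : Pro P Q → Set} (cut : IsCut P Q I F) where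

      UpAsc-DImg⇒AlexDual : WellFounded P → WellFounded Q →
        ∀ T → UpAsc (DImg I) T → AlexDual (UpAsc F) T
      UpAsc-DImg⇒AlexDual wfP wfQ T (g , (f' , If' , Df'≋g) , Λg⊆T) =
        S , S∉UpAsc , λ p q → mk⇔ (λ t ¬t → ¬t t) dne
        where
        S : Subset (Carrier Q × Carrier P)
        S (q , p) = ¬ T (p , q)
        S∉UpAsc : ¬ UpAsc F S
        S∉UpAsc (f , Ff , Λf⊆S) with ⋢⇒shared-ascent wfP wfQ f f' (F⇒⋢I cut {f} {f'} Ff If')
        ... | q , p , Λf-qp , ΛDf'-pq =
          Λf⊆S (q , p) Λf-qp (Λg⊆T (p , q) (Λ-resp-≋ {f = D f'} {g} Df'≋g (p , q) ΛDf'-pq))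

      AlexDual⇒UpAsc-DImg : ∀ T → AlexDual (UpAsc F) T → UpAsc (DImg I) T
      AlexDual⇒UpAsc-DImg T (S , S∉UpAsc , T⇔¬S) = by-cut (dec (I maxAvoiding))
        where
        open MaxAvoiding T

        ΛM⊆S : Λ maxAvoiding ⊆ S
        ΛM⊆S (q , p) ascent =
          dne λ ¬S → maxAvoiding-avoids q p ascent (Equivalence.from (T⇔¬S p q) ¬S)

        by-cut : Dec (I maxAvoiding) → UpAsc (DImg I) T
        by-cut (yes IM) = D maxAvoiding , (maxAvoiding , IM , ≋-refl (D maxAvoiding)) , Λ-D-maxAvoiding⊆
        by-cut (no ¬IM) = ⊥-elim (S∉UpAsc (maxAvoiding , ¬I⇒F cut maxAvoiding ¬IM , ΛM⊆S))

theorem3p10 : ExcludedMiddle (lsuc 0ℓ) →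
    (P Q : Pos) → WellFounded P → WellFounded Q →
    (I F : Pro P Q → Set) → IsCut P Q I F →
    IsCut Q P (DImg F) (DImg I) ×
    (∀ (T : Subset (Carrier P × Carrier Q)) →
       UpAsc (DImg I) T ⇔ AlexDual (UpAsc F) T)
theorem3p10 em P Q wfP wfQ I F cut =
  cut-dual cut , λ T → mk⇔ (UpAsc-DImg⇒AlexDual cut wfP wfQ T) (AlexDual⇒UpAsc-DImg cut T)
  where open Classical em
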